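{- For all nonnegative integers $m, k, r$ with $k \geq r$, $$\sum_{j=k+1}^m (-1)^j \binom{j-1}{r-1} \binom{m}{j} = (-1)^{k+1} \sum_{i=1}^r \binom{k-i}{r-i} \binom{m-i}{k-i+1}$$ (an empty sum being $0$).
   Context: Binomial convention: for integers $s,t$, $\binom{t}{s}=0$ if $\min(s,t)<0$ or $s>t$; otherwise $\binom{t}{s}=\frac{t!}{s!(t-s)!}$. -}

module Defs where

open import Data.Nat using (ℕ; zero; suc; _∸_)
import Data.Nat as ℕ
open import Data.Nat.Combinatorics using (_C_)
open import Data.Integer using (ℤ; +_; -[1+_]; _+_; -_; 0ℤ; 1ℤ)

-- Binomial coefficient with the paper's convention:
-- (t choose s) = 0 if min(s,t) < 0 or s > t, else t!/(s!(t-s)!).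
-- For naturals s ≤ t, stdlib's  t C s  is t!/(s!(t-s)!), and  t C s = 0 when s > t.
binom : ℤ → ℤ → ℤ
binom (+ t) (+ s) = + (t C s)
binom (+ t) -[1+ s ] = 0ℤ
binom -[1+ t ] s = 0ℤ

sgn : ℕ → ℤ
sgn zero = 1ℤ
sgn (suc n) = - sgn n

sumN : ℕ → ℕ → (ℕ → ℤ) → ℤ
sumN a zero f = 0ℤ
sumN a (suc n) f = f a + sumN (suc a) n f

-- Σ_{j=a}^{b} f j over naturals; empty sum (= 0) when b < a.
sumFromTo : ℕ → ℕ → (ℕ → ℤ) → ℤ
sumFromTo a b f = sumN a (suc b ∸ a) f

{-# OPTIONS --safe #-}
-- Write R_k for the right-hand sum without its sign, computed in ℕ; for r ≤ k the
-- truncated subtractions there are harmless. Pascal's rule, applied while m, k and r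
-- decrease together, gives R_k + R_(k+1) = C(k, r-1) C(m, k+1) for r ≤ k. Hence the
-- j-th term on the left is (-1)^j (R_(j-1) + R_j), so the left-hand sum telescopes to
-- (-1)^(k+1) R_k + (-1)^n R_n with n = max(k, m), and R_n = 0 because n ≥ m.
module Submission where

open import Defs
open import Data.Nat as ℕ using (ℕ; zero; suc; _∸_; _≤_; _≥_; _<_; z≤n; s≤s)
open import Data.Nat.Properties as ℕ
  using (≤-refl; ≤-trans; ≤-pred; <⇒≤; ≰⇒>; +-suc; +-comm; *-zeroʳ; ∸-monoˡ-≤; +-∸-assoc; m≤n⇒m∸n≡0; m≤n+m∸n; _≤?_)
open import Data.Nat.Solver using (module +-*-Solver)
open import Data.Nat.Combinatorics using (_C_; k>n⇒nCk≡0; nCk+nC[k+1]≡[n+1]C[k+1])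
open import Data.Integer using (ℤ; +_; -[1+_]; _+_; _-_; _*_; -_; 0ℤ; _⊖_)
open import Data.Integer.Properties as ℤ using (m-n≡m⊖n; ⊖-≥; ⊖-<; pos-+; pos-*; +-identityʳ)
open import Data.Integer.Tactic.RingSolver using (solve-∀)
open import Function using (_∘_)
open import Relation.Binary.PropositionalEquality using (_≡_; refl; sym; trans; cong; cong₂; subst; module ≡-Reasoning)
open import Relation.Nullary using (yes; no)

open ≡-Reasoning

sumℕ : ℕ → ℕ → (ℕ → ℕ) → ℕ
sumℕ a zero    f = 0
sumℕ a (suc n) f = f a ℕ.+ sumℕ (suc a) n f

sumℕ-shift : ∀ a n {f g : ℕ → ℕ} → (∀ i → g (suc i) ≡ f i) → sumℕ (suc a) n g ≡ sumℕ a n f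
sumℕ-shift a zero    g∘suc≗f = refl
sumℕ-shift a (suc n) g∘suc≗f = cong₂ ℕ._+_ (g∘suc≗f a) (sumℕ-shift (suc a) n g∘suc≗f)

sumℕ-zero : ∀ a n {f : ℕ → ℕ} → (∀ i → f i ≡ 0) → sumℕ a n f ≡ 0
sumℕ-zero a zero    f≗0 = refl
sumℕ-zero a (suc n) f≗0 = cong₂ ℕ._+_ (f≗0 a) (sumℕ-zero (suc a) n f≗0)

sumN-pos : ∀ a n (f : ℕ → ℕ) → sumN a n (+_ ∘ f) ≡ + sumℕ a n f
sumN-pos a zero    f = refl
sumN-pos a (suc n) f = begin
  + f a + sumN (suc a) n (+_ ∘ f) ≡⟨ cong (λ s → + f a + s) (sumN-pos (suc a) n f) ⟩
  + f a + + sumℕ (suc a) n f      ≡⟨ pos-+ (f a) (sumℕ (suc a) n f) ⟨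
  + sumℕ a (suc n) f              ∎

sumN-cong : ∀ a n {f g : ℕ → ℤ} → (∀ i → i < a ℕ.+ n → f i ≡ g i) → sumN a n f ≡ sumN a n g
sumN-cong a zero    f≗g = refl
sumN-cong a (suc n) {f} {g} f≗g = cong₂ _+_ (f≗g a (ℕ.m<m+n a ℕ.0<1+n)) (sumN-cong (suc a) n f≗g′)
  where
  f≗g′ : ∀ i → i < suc a ℕ.+ n → f i ≡ g i
  f≗g′ i i<1+a+n = f≗g i (subst (i <_) (sym (+-suc a n)) i<1+a+n)

R : ℕ → ℕ → ℕ → ℕ
R m k r = sumℕ 1 r (λ i → ((k ∸ i) C (r ∸ i)) ℕ.* ((m ∸ i) C suc (k ∸ i)))

R-suc : ∀ m k r → R (suc m) (suc k) (suc r) ≡ (k C r) ℕ.* (m C suc k) ℕ.+ R m k r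
R-suc m k r = cong ((k C r) ℕ.* (m C suc k) ℕ.+_) (sumℕ-shift 1 r (λ _ → refl))

R-vanishes : ∀ {m k} r → m ≤ k → R m k r ≡ 0
R-vanishes {m} {k} r m≤k = sumℕ-zero 1 r λ i → begin
  ((k ∸ i) C (r ∸ i)) ℕ.* ((m ∸ i) C suc (k ∸ i)) ≡⟨ cong (((k ∸ i) C (r ∸ i)) ℕ.*_) (k>n⇒nCk≡0 (s≤s (∸-monoˡ-≤ i m≤k))) ⟩
  ((k ∸ i) C (r ∸ i)) ℕ.* 0                       ≡⟨ *-zeroʳ ((k ∸ i) C (r ∸ i)) ⟩
  0                                             ∎

R-pascal : ∀ m k r → r < k → R m k (suc r) ℕ.+ R m (suc k) (suc r) ≡ (k C r) ℕ.* (m C suc k)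
R-pascal zero k r _ = begin
  R 0 k (suc r) ℕ.+ R 0 (suc k) (suc r) ≡⟨ cong₂ ℕ._+_ (R-vanishes (suc r) z≤n) (R-vanishes (suc r) z≤n) ⟩
  0                                     ≡⟨ *-zeroʳ (k C r) ⟨
  (k C r) ℕ.* (0 C suc k)               ∎
R-pascal (suc m) (suc k) zero _ = begin
  (1 ℕ.* A ℕ.+ 0) ℕ.+ (1 ℕ.* B ℕ.+ 0) ≡⟨ solve 2 (λ A B → (con 1 :* A :+ con 0) :+ (con 1 :* B :+ con 0) := A :+ B) refl A B ⟩
  A ℕ.+ B                             ≡⟨ nCk+nC[k+1]≡[n+1]C[k+1] m (suc k) ⟩
  suc m C suc (suc k)                 ≡⟨ ℕ.*-identityˡ (suc m C suc (suc k)) ⟨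
  1 ℕ.* (suc m C suc (suc k))         ∎
  where
  open +-*-Solver
  A B : ℕ
  A = m C suc k
  B = m C suc (suc k)
R-pascal (suc m) (suc k) (suc r) (s≤s r<k) = begin
  R (suc m) (suc k) (suc (suc r)) ℕ.+ R (suc m) (suc (suc k)) (suc (suc r))
    ≡⟨ cong₂ ℕ._+_ (R-suc m k (suc r)) (R-suc m (suc k) (suc r)) ⟩
  (c₁ ℕ.* A ℕ.+ R₁) ℕ.+ ((suc k C suc r) ℕ.* B ℕ.+ R₂)
    ≡⟨ cong (λ c → (c₁ ℕ.* A ℕ.+ R₁) ℕ.+ (c ℕ.* B ℕ.+ R₂)) (nCk+nC[k+1]≡[n+1]C[k+1] k r) ⟨
  (c₁ ℕ.* A ℕ.+ R₁) ℕ.+ ((c₀ ℕ.+ c₁) ℕ.* B ℕ.+ R₂)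
    ≡⟨ solve 6 (λ c₀ c₁ A B R₁ R₂ → (c₁ :* A :+ R₁) :+ ((c₀ :+ c₁) :* B :+ R₂)
                                  := (c₁ :* A :+ (c₀ :+ c₁) :* B) :+ (R₁ :+ R₂)) refl c₀ c₁ A B R₁ R₂ ⟩
  (c₁ ℕ.* A ℕ.+ (c₀ ℕ.+ c₁) ℕ.* B) ℕ.+ (R₁ ℕ.+ R₂)
    ≡⟨ cong ((c₁ ℕ.* A ℕ.+ (c₀ ℕ.+ c₁) ℕ.* B) ℕ.+_) (R-pascal m k r r<k) ⟩
  (c₁ ℕ.* A ℕ.+ (c₀ ℕ.+ c₁) ℕ.* B) ℕ.+ c₀ ℕ.* A
    ≡⟨ solve 4 (λ c₀ c₁ A B → (c₁ :* A :+ (c₀ :+ c₁) :* B) :+ c₀ :* A := (c₀ :+ c₁) :* (A :+ B)) refl c₀ c₁ A B ⟩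
  (c₀ ℕ.+ c₁) ℕ.* (A ℕ.+ B)
    ≡⟨ cong₂ ℕ._*_ (nCk+nC[k+1]≡[n+1]C[k+1] k r) (nCk+nC[k+1]≡[n+1]C[k+1] m (suc k)) ⟩
  (suc k C suc r) ℕ.* (suc m C suc (suc k)) ∎
  where
  open +-*-Solver
  c₀ c₁ A B R₁ R₂ : ℕ
  c₀ = k C r
  c₁ = k C suc r
  A  = m C suc k
  B  = m C suc (suc k)
  R₁ = R m k (suc r)
  R₂ = R m (suc k) (suc r)

+m-+n≡+[m∸n] : ∀ {m n} → n ≤ m → + m - + n ≡ + (m ∸ n)
+m-+n≡+[m∸n] {m} {n} n≤m = trans (m-n≡m⊖n m n) (⊖-≥ n≤m)

binom-negative : ∀ {t i} y → t < i → binom (+ t - + i) y ≡ 0ℤ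
binom-negative {t} {suc i} y (s≤s t≤i) = cong (λ x → binom x y) (begin
  + t - + suc i      ≡⟨ m-n≡m⊖n t (suc i) ⟩
  t ⊖ suc i          ≡⟨ ⊖-< (s≤s t≤i) ⟩
  - + (suc i ∸ t)    ≡⟨ cong (-_ ∘ +_) (+-∸-assoc 1 t≤i) ⟩
  -[1+ i ∸ t ]       ∎)

binom-∸ : ∀ t i s → binom (+ t - + i) (+ suc s) ≡ + ((t ∸ i) C suc s)
binom-∸ t i s with i ≤? t
... | yes i≤t = cong (λ x → binom x (+ suc s)) (+m-+n≡+[m∸n] i≤t)
... | no  i≰t = begin
  binom (+ t - + i) (+ suc s) ≡⟨ binom-negative (+ suc s) (≰⇒> i≰t) ⟩
  + (0 C suc s)               ≡⟨ cong (λ d → + (d C suc s)) (m≤n⇒m∸n≡0 (<⇒≤ (≰⇒> i≰t))) ⟨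
  + ((t ∸ i) C suc s)         ∎

rhs-summand : ∀ m k r i → i ≤ r → r ≤ k →
  binom (+ k - + i) (+ r - + i) * binom (+ m - + i) (+ k - + i + + 1)
    ≡ + (((k ∸ i) C (r ∸ i)) ℕ.* ((m ∸ i) C suc (k ∸ i)))
rhs-summand m k r i i≤r r≤k = begin
  binom (+ k - + i) (+ r - + i) * binom (+ m - + i) (+ k - + i + + 1)
    ≡⟨ cong₂ (λ x y → binom x y * binom (+ m - + i) (x + + 1)) (+m-+n≡+[m∸n] (≤-trans i≤r r≤k)) (+m-+n≡+[m∸n] i≤r) ⟩
  + c * binom (+ m - + i) (+ (k ∸ i ℕ.+ 1))
    ≡⟨ cong (λ d → + c * binom (+ m - + i) (+ d)) (+-comm (k ∸ i) 1) ⟩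
  + c * binom (+ m - + i) (+ suc (k ∸ i))
    ≡⟨ cong (+ c *_) (binom-∸ m i (k ∸ i)) ⟩
  + c * + ((m ∸ i) C suc (k ∸ i))
    ≡⟨ pos-* c ((m ∸ i) C suc (k ∸ i)) ⟨
  + (c ℕ.* ((m ∸ i) C suc (k ∸ i))) ∎
  where
  c : ℕ
  c = (k ∸ i) C (r ∸ i)

rhs≡R : ∀ m k r → r ≤ k →
  sumFromTo 1 r (λ i → binom (+ k - + i) (+ r - + i) * binom (+ m - + i) (+ k - + i + + 1)) ≡ + R m k r
rhs≡R m k r r≤k = trans (sumN-cong 1 r (λ i i<1+r → rhs-summand m k r i (≤-pred i<1+r) r≤k)) (sumN-pos 1 r _)

lhs-summand : ∀ m r j → r ≤ j →
  sgn (suc j) * (binom (+ suc j - + 1) (+ r - + 1) * binom (+ m) (+ suc j))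
    ≡ sgn (suc j) * (+ R m j r + + R m (suc j) r)
-- For r = 0 both sides compute to 0: binom _ (+ 0 - + 1) is binom _ -1 = 0, and R _ _ 0 is empty.
lhs-summand m zero    j _ = refl
lhs-summand m (suc r) j r≤j = cong (sgn (suc j) *_) (begin
  + (j C r) * + (m C suc j)          ≡⟨ pos-* (j C r) (m C suc j) ⟨
  + ((j C r) ℕ.* (m C suc j))        ≡⟨ cong +_ (R-pascal m j r r≤j) ⟨
  + (R m j (suc r) ℕ.+ R m (suc j) (suc r)) ≡⟨ pos-+ (R m j (suc r)) (R m (suc j) (suc r)) ⟩
  + R m j (suc r) + + R m (suc j) (suc r) ∎)

alternating-telescope : ∀ a n {F G : ℕ → ℤ} → (∀ j → a ≤ j → F (suc j) ≡ sgn (suc j) * (G j + G (suc j))) →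
  sumN (suc a) n F ≡ sgn (suc a) * G a + sgn (a ℕ.+ n) * G (a ℕ.+ n)
alternating-telescope a zero {G = G} _ rewrite ℕ.+-identityʳ a = cancel (sgn a) (G a)
  where
  cancel : ∀ u x → 0ℤ ≡ - u * x + u * x
  cancel = solve-∀
alternating-telescope a (suc n) {F} {G} F≡ = begin
  F (suc a) + sumN (suc (suc a)) n F
    ≡⟨ cong₂ _+_ (F≡ a ≤-refl) (alternating-telescope (suc a) n {G = G} (λ j a<j → F≡ j (<⇒≤ a<j))) ⟩
  s * (G a + G (suc a)) + (- s * G (suc a) + sgn (suc (a ℕ.+ n)) * G (suc (a ℕ.+ n)))
    ≡⟨ telescope s (G a) (G (suc a)) (sgn (suc (a ℕ.+ n)) * G (suc (a ℕ.+ n))) ⟩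
  s * G a + sgn (suc (a ℕ.+ n)) * G (suc (a ℕ.+ n))
    ≡⟨ cong (λ b → s * G a + sgn b * G b) (+-suc a n) ⟨
  s * G a + sgn (a ℕ.+ suc n) * G (a ℕ.+ suc n) ∎
  where
  s : ℤ
  s = sgn (suc a)
  telescope : ∀ u x y t → u * (x + y) + (- u * y + t) ≡ u * x + t
  telescope = solve-∀

lemma2 : (m k r : ℕ) → k ≥ r →
    sumFromTo (suc k) m (λ j → sgn j * (binom (+ j - + 1) (+ r - + 1) * binom (+ m) (+ j)))
      ≡ sgn (suc k) * sumFromTo 1 r (λ i → binom (+ k - + i) (+ r - + i) * binom (+ m - + i) (+ k - + i + + 1))
lemma2 m k r r≤k = begin
  sumN (suc k) (m ∸ k) (λ j → sgn j * (binom (+ j - + 1) (+ r - + 1) * binom (+ m) (+ j)))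
    ≡⟨ alternating-telescope k (m ∸ k) {G = λ j → + R m j r} (λ j k≤j → lhs-summand m r j (≤-trans r≤k k≤j)) ⟩
  sgn (suc k) * + R m k r + sgn n * + R m n r
    ≡⟨ cong (λ x → sgn (suc k) * + R m k r + sgn n * + x) (R-vanishes r (m≤n+m∸n m k)) ⟩
  sgn (suc k) * + R m k r + sgn n * 0ℤ
    ≡⟨ cong (λ x → sgn (suc k) * + R m k r + x) (ℤ.*-zeroʳ (sgn n)) ⟩
  sgn (suc k) * + R m k r + 0ℤ
    ≡⟨ +-identityʳ _ ⟩
  sgn (suc k) * + R m k r
    ≡⟨ cong (sgn (suc k) *_) (rhs≡R m k r r≤k) ⟨
  sgn (suc k) * sumFromTo 1 r (λ i → binom (+ k - + i) (+ r - + i) * binom (+ m - + i) (+ k - + i + + 1)) ∎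
  where
  n : ℕ
  n = k ℕ.+ (m ∸ k)
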